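{- Let $n\ge2$. A tuple $(t_1,\dots,t_{n-1})$ of positive integers is the pattern of some $n$-array if and only if $t_j\le j$ for all $1\le j\le n-1$.
   Context: An $n$-signature is a tuple of integers $(n,b_s,\dots,b_1)$ with $n=b_{s+1}>b_s>\dots>b_1=1$ and $b_{j+1}\le 2b_j$ for $j=1,\dots,s$. The tower of a signature consists of $n-1$ cells at heights $1,\dots,n-1$, partitioned into blocks: the $j$-th block consists of the cells at heights $b_j,\dots,b_{j+1}-1$, and its position is $b_j$. An array associated to the signature is an assignment of a positive integer to each cell such that the numbers in the $j$-th block belong to $\{1,\dots,b_j\}$ and are strictly decreasing as the height increases. An $n$-array is an array associated to some $n$-signature. The pattern of an array is the tuple $(t_1,\dots,t_{n-1})$ where $t_h$ is the number in the cell at height $h$. -}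

module Defs where

open import Data.Nat using (ℕ; suc; _+_; _*_; _∸_; _≤_; _<_)
open import Data.Fin using (Fin; toℕ)
open import Data.Vec using (Vec; lookup)
open import Data.List using (List; []; _∷_; _++_; [_])
open import Data.Product using (_×_; ∃)
open import Relation.Binary.PropositionalEquality using (_≡_)

SigStep : ℕ → ℕ → Set
SigStep x y = x < y × y ≤ 2 * x

data SigChain : List ℕ → Set where
  [] : SigChain []
  [-] : ∀ {x} → SigChain (x ∷ [])
  _∷_ : ∀ {x y xs} → SigStep x y → SigChain (y ∷ xs) → SigChain (x ∷ y ∷ xs)

-- An n-signature (n, b_s, ..., b_1) is encoded by the list of block
-- positions  bs = b_1 ∷ b_2 ∷ ... ∷ b_s  (increasing order).
IsSignature : ℕ → List ℕ → Set
IsSignature n bs = (∃ λ rest → bs ≡ 1 ∷ rest) × SigChain (bs ++ [ n ])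

data Adjacent : List ℕ → ℕ → ℕ → Set where
  here  : ∀ {x y xs} → Adjacent (x ∷ y ∷ xs) x y
  there : ∀ {z xs x y} → Adjacent xs x y → Adjacent (z ∷ xs) x y

height : ∀ {m} → Fin m → ℕ
height i = suc (toℕ i)

-- A filling t of the n-1 cells (cell at height h is  lookup t (h-1))
-- is an array associated to the signature with positions bs:
-- for every block [b, b') (b = b_j, b' = b_{j+1}, with b_{s+1} = n),
-- every cell in it holds a number in {1..b}, and the numbers strictly
-- decrease as the height increases within the block.
IsArrayFor : (n : ℕ) → List ℕ → Vec ℕ (n ∸ 1) → Set
IsArrayFor n bs t =
  ∀ b b' → Adjacent (bs ++ [ n ]) b b' →
    (∀ (i : Fin (n ∸ 1)) → b ≤ height i → height i < b' →
        1 ≤ lookup t i × lookup t i ≤ b)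
    × (∀ (i j : Fin (n ∸ 1)) → b ≤ height i → height j < b' →
        height j ≡ height i + 1 → lookup t j < lookup t i)

-- t is the pattern of some n-array. (An array is an assignment of numbers
-- to cells at heights 1..n-1; its pattern is exactly that tuple.)
IsPatternOfArray : (n : ℕ) → Vec ℕ (n ∸ 1) → Set
IsPatternOfArray n t = ∃ λ bs → IsSignature n bs × IsArrayFor n bs t

-- A cell at height h lies in the block of some position b ≤ h, and the numbers in
-- that block are at most b, so the pattern of any array satisfies t_h ≤ h.
-- Conversely, the signature (n, n-1, …, 2, 1) has only one-cell blocks, each at the
-- position equal to its height, so the monotonicity condition is vacuous and any
-- tuple with 1 ≤ t_h ≤ h is the pattern of an array for it.
module Submission where

open import Defs
open import Data.Nat using (ℕ; zero; suc; _+_; _∸_; _≤_; _<_; s≤s; z≤n)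
open import Data.Nat.Properties
open import Data.Fin using (Fin; toℕ)
open import Data.Fin.Properties using (toℕ<n)
open import Data.List using (List; []; _∷_; _++_; [_]; iterate)
open import Data.Vec using (Vec; lookup)
open import Data.Empty using (⊥-elim)
open import Data.Product using (Σ-syntax; _×_; _,_; proj₁; proj₂)
open import Function.Bundles using (_⇔_; mk⇔)
open import Relation.Binary.PropositionalEquality
  using (_≡_; refl; sym; cong; subst; module ≡-Reasoning)
open import Relation.Nullary using (yes; no)

height<n : ∀ n (i : Fin (n ∸ 1)) → height i < n
height<n (suc n) i = s≤s (toℕ<n i)

adjacent-straddling : ∀ {n h} x xs → x ≤ h → h < n →
  Σ[ b ∈ ℕ ] Σ[ b' ∈ ℕ ] Adjacent (x ∷ xs ++ [ n ]) b b' × b ≤ h × h < b'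
adjacent-straddling x []       x≤h h<n = x , _ , here , x≤h , h<n
adjacent-straddling {h = h} x (y ∷ ys) x≤h h<n with h <? y
... | yes h<y = x , y , here , x≤h , h<y
... | no  h≮y with adjacent-straddling y ys (≮⇒≥ h≮y) h<n
...   | b , b' , adj , b≤h , h<b' = b , b' , there adj , b≤h , h<b'

pattern-bounded-by-height : ∀ n (t : Vec ℕ (n ∸ 1)) →
  IsPatternOfArray n t → ∀ (i : Fin (n ∸ 1)) → lookup t i ≤ height i
pattern-bounded-by-height n t (_ , ((rest , refl) , _) , array) i
  with adjacent-straddling 1 rest (s≤s z≤n) (height<n n i)
... | b , b' , adj , b≤h , h<b' =
  ≤-trans (proj₂ (proj₁ (array b b' adj) i b≤h h<b')) b≤h

sigStep-suc : ∀ {a} → 1 ≤ a → SigStep a (suc a)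
sigStep-suc {a} 1≤a =
  n<1+n a , ≤-trans (+-monoˡ-≤ a 1≤a) (≤-reflexive (cong (a +_) (sym (+-identityʳ a))))

iterate-suc-∷ʳ : ∀ a k → iterate suc a k ++ [ a + k ] ≡ iterate suc a (suc k)
iterate-suc-∷ʳ a zero    = cong (λ c → c ∷ _) (+-identityʳ a)
iterate-suc-∷ʳ a (suc k) = begin
  a ∷ iterate suc (suc a) k ++ [ a + suc k ]
    ≡⟨ cong (λ c → a ∷ iterate suc (suc a) k ++ [ c ]) (+-suc a k) ⟩
  a ∷ iterate suc (suc a) k ++ [ suc a + k ]
    ≡⟨ cong (a ∷_) (iterate-suc-∷ʳ (suc a) k) ⟩
  a ∷ iterate suc (suc a) (suc k)
    ∎
  where open ≡-Reasoning

iterate-suc-sigChain : ∀ {a} k → 1 ≤ a → SigChain (iterate suc a k)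
iterate-suc-sigChain zero          _   = []
iterate-suc-sigChain (suc zero)    _   = [-]
iterate-suc-sigChain (suc (suc k)) 1≤a =
  sigStep-suc 1≤a ∷ iterate-suc-sigChain (suc k) (m≤n⇒m≤1+n 1≤a)

iterate-suc-adjacent : ∀ {a b b'} k → Adjacent (iterate suc a k) b b' → b' ≡ suc b
iterate-suc-adjacent (suc (suc k)) here        = refl
iterate-suc-adjacent (suc k)       (there adj) = iterate-suc-adjacent k adj

singleton-blocks-array : ∀ n bs (t : Vec ℕ (n ∸ 1)) →
  (∀ {b b'} → Adjacent (bs ++ [ n ]) b b' → b' ≡ suc b) →
  (∀ (i : Fin (n ∸ 1)) → 1 ≤ lookup t i) →
  (∀ (i : Fin (n ∸ 1)) → lookup t i ≤ height i) →
  IsArrayFor n bs t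
singleton-blocks-array n bs t singleton positive bounded b b' adj
  with singleton adj
... | refl = in-range , decreasing
  where
  in-range : ∀ i → b ≤ height i → height i < suc b → 1 ≤ lookup t i × lookup t i ≤ b
  in-range i b≤h h<b' =
    positive i , subst (lookup t i ≤_) (≤-antisym (m<1+n⇒m≤n h<b') b≤h) (bounded i)
  decreasing : ∀ i j → b ≤ height i → height j < suc b → height j ≡ height i + 1 →
    lookup t j < lookup t i
  decreasing i j b≤hi hj<b' hj≡hi+1 =
    ⊥-elim (<⇒≱ (m<m+n (height i) (s≤s z≤n)) hi+1≤hi)
    where
    hi+1≤hi : height i + 1 ≤ height i
    hi+1≤hi = subst (_≤ height i) hj≡hi+1 (≤-trans (m<1+n⇒m≤n hj<b') b≤hi)

lemma3 : (n : ℕ) → 2 ≤ n → (t : Vec ℕ (n ∸ 1)) →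
    (∀ (i : Fin (n ∸ 1)) → 1 ≤ lookup t i) →
    (IsPatternOfArray n t ⇔ (∀ (i : Fin (n ∸ 1)) → lookup t i ≤ height i))
lemma3 n@(suc (suc m)) (s≤s (s≤s z≤n)) t positive =
  mk⇔ (pattern-bounded-by-height n t) λ bounded →
    bs , ((iterate suc 2 m , refl) , blocks-chain) ,
    singleton-blocks-array n bs t blocks-adjacent positive bounded
  where
  bs : List ℕ
  bs = iterate suc 1 (suc m)

  bs∷ʳn : bs ++ [ n ] ≡ iterate suc 1 n
  bs∷ʳn = iterate-suc-∷ʳ 1 (suc m)

  blocks-chain : SigChain (bs ++ [ n ])
  blocks-chain = subst SigChain (sym bs∷ʳn) (iterate-suc-sigChain n (s≤s z≤n))

  blocks-adjacent : ∀ {b b'} → Adjacent (bs ++ [ n ]) b b' → b' ≡ suc b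
  blocks-adjacent {b} {b'} adj =
    iterate-suc-adjacent n (subst (λ xs → Adjacent xs b b') bs∷ʳn adj)
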